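{- If $\Gamma$ is a complete graph $K_n$, then $\Gamma$ has property R, i.e. every class of heaps $H(P,\mathcal{C})$ whose concurrency graph is $K_n$ is regular.
   Context: Let $P$ be a set with a symmetric reflexive relation $\mathcal{C}$. A labelled heap is $(E,\le,\varepsilon)$ with $(E,\le)$ a finite poset, $\varepsilon:E\to P$, such that elements with $\varepsilon(a)\,\mathcal{C}\,\varepsilon(b)$ are comparable and $\le$ is the transitive closure of "$a\le b$ and $\varepsilon(a)\,\mathcal{C}\,\varepsilon(b)$"; heaps are label-preserving isomorphism classes, forming $H(P,\mathcal{C})$. $E(v)$ is the subheap on $E\setminus\{v\}$ (order: transitive closure of the same relation restricted). A heap is trivial if its order is trivial. A convex chain is a chain $x_1<\dots<x_t$ containing every $y$ with $x_i<y<x_j$; length $t$; balanced if $\varepsilon(x_1)=\varepsilon(x_t)$. Property P2: no balanced convex chain of length 2 or 3. $E(a)\prec^+E$ if $a$ is maximal in $E$ and some element maximal in $E(a)$ but not in $E$ has label $\ne\varepsilon(a)$; $\prec^-$ likewise with minimal elements; $\prec$ means either. Property P1: there is a (possibly trivial) sequence $E_1\prec\cdots\prec E$ with $E_1$ trivial. The concurrency graph of $H(P,\mathcal{C})$ has vertices $P$ and edges between distinct $v,w$ with $v\,\mathcal{C}\,w$. A graph has property R if it is the concurrency graph of a regular class of heaps, i.e. one in which every heap with property P2 has property P1. -}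

module Defs where

open import Data.Nat using (ℕ; zero; suc)
open import Data.Fin using (Fin; fromℕ) renaming (_<_ to _<ᶠ_)
open import Data.Product using (Σ; ∃; _×_; _,_)
open import Data.Sum using (_⊎_)
open import Relation.Nullary using (¬_)
open import Relation.Binary.PropositionalEquality using (_≡_; _≢_)
open import Relation.Binary.Structures using (IsPartialOrder)
open import Relation.Binary.Construct.Closure.Transitive using (TransClosure)
open import Relation.Unary using (Pred; _∈_; _∉_; Universal)
open import Level using (0ℓ)

record LHeap (P : Set) (C : P → P → Set) : Set₁ where
  field
    m           : ℕ
    _≤_         : Fin m → Fin m → Set
    ε           : Fin m → P
    isPO        : IsPartialOrder _≡_ _≤_
    comparable  : ∀ a b → C (ε a) (ε b) → (a ≤ b) ⊎ (b ≤ a)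
    generated   : ∀ a b → a ≤ b → TransClosure (λ x y → (x ≤ y) × C (ε x) (ε y)) a b

  _<_ : Fin m → Fin m → Set
  a < b = (a ≤ b) × (a ≢ b)

  -- Subheaps: a subheap is given by its set S ⊆ E of elements; its order
  -- is the transitive closure (within S) of "a ≤ b and ε(a) C ε(b)".
  Sub : Set₁
  Sub = Pred (Fin m) 0ℓ

  Gen : Sub → Fin m → Fin m → Set
  Gen S a b = (a ∈ S) × (b ∈ S) × (a ≤ b) × C (ε a) (ε b)

  Ord : Sub → Fin m → Fin m → Set
  Ord S = TransClosure (Gen S)

  remove : Sub → Fin m → Sub
  remove S v x = (x ∈ S) × (x ≢ v)

  Full : Sub
  Full _ = Data.Unit.⊤
    where import Data.Unit

  Maximal : Sub → Fin m → Set
  Maximal S a = (a ∈ S) × (∀ b → b ∈ S → Ord S a b → b ≡ a)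

  Minimal : Sub → Fin m → Set
  Minimal S a = (a ∈ S) × (∀ b → b ∈ S → Ord S b a → b ≡ a)

  Trivial : Sub → Set
  Trivial S = ∀ a b → a ∈ S → b ∈ S → Ord S a b → a ≡ b

  Prec⁺ : Sub → Fin m → Set
  Prec⁺ S a = Maximal S a ×
    (Σ (Fin m) λ b → Maximal (remove S a) b × ¬ Maximal S b × ε b ≢ ε a)

  Prec⁻ : Sub → Fin m → Set
  Prec⁻ S a = Minimal S a ×
    (Σ (Fin m) λ b → Minimal (remove S a) b × ¬ Minimal S b × ε b ≢ ε a)

  data ReachFromTrivial : Sub → Set₁ where
    base : ∀ {S} → Trivial S → ReachFromTrivial S
    step : ∀ {S} a → (Prec⁺ S a ⊎ Prec⁻ S a) →
           ReachFromTrivial (remove S a) → ReachFromTrivial S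

  P1 : Set₁
  P1 = ReachFromTrivial Full

  -- Convex chains in E, of length t = suc k, given by x : Fin t → E.
  ConvexChain : (k : ℕ) → (Fin (suc k) → Fin m) → Set
  ConvexChain k x =
    (∀ i j → i <ᶠ j → x i < x j) ×
    (∀ y i j → x i < y → y < x j → Σ (Fin (suc k)) λ l → y ≡ x l)

  Balanced : (k : ℕ) → (Fin (suc k) → Fin m) → Set
  Balanced k x = ε (x Fin.zero) ≡ ε (x (fromℕ k))
    where import Data.Fin as Fin

  P2 : Set
  P2 = ∀ k x → (k ≡ 1 ⊎ k ≡ 2) → ConvexChain k x → ¬ Balanced k x

Regular : (P : Set) (C : P → P → Set) → Set₁
Regular P C = (H : LHeap P C) → LHeap.P2 H → LHeap.P1 H

-- When all labels are pairwise concurrent, the order of a heap is total,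
-- so a heap is a chain, and P2 says that consecutive elements of this
-- chain carry distinct labels. Removing the top element a therefore always
-- exhibits E(a) ≺⁺ E: the new top b was covered by a and has a different
-- label. Iterating this down the chain ends with at most one element left,
-- which is a trivial heap.
module Submission where

open import Data.Fin using (Fin; zero; suc; _≟_) renaming (_<_ to _<ᶠ_)
open import Data.Fin.Induction using (po-wellFounded; po-noetherian)
open import Data.Fin.Properties using (any?; inj⇒≟)
open import Data.Nat using (ℕ; s≤s)
open import Data.Product using (Σ; ∃; _×_; _,_)
open import Data.Sum using (_⊎_; inj₁; inj₂)
open import Data.Unit using (tt)
open import Data.Empty using (⊥-elim)
open import Defs
open import Function.Bundles using (_↔_)
open import Function.Properties.Inverse using (↔⇒↣)
open import Induction.WellFounded using (Acc; acc)
open import Level using (0ℓ)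
open import Relation.Binary.Bundles using (Poset; TotalOrder; module DecTotalOrder)
open import Relation.Binary.Construct.Closure.Transitive using ([_]; _∷_)
import Relation.Binary.Construct.NonStrictToStrict as ToStrict
open import Relation.Binary.Definitions using (Reflexive; Symmetric)
import Relation.Binary.Properties.Poset as PosetProperties
import Relation.Binary.Properties.TotalOrder as TotalOrderProperties
open import Relation.Binary.PropositionalEquality
  using (_≡_; _≢_; refl; sym; trans)
open import Relation.Binary.Structures using (IsPartialOrder)
open import Relation.Nullary using (¬_; Dec; yes; no)
open import Relation.Nullary.Decidable using (_×-dec_)
open import Relation.Unary using (Pred; Decidable; _∈_; _∉_; _⊆_; _≐_)

module HeapProperties {P : Set} {C : P → P → Set} (H : LHeap P C) where
  open LHeap H public
  open IsPartialOrder isPO public using (antisym) renaming (trans to ≤-trans)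

  poset : Poset 0ℓ 0ℓ 0ℓ
  poset = record { isPartialOrder = isPO }

  open PosetProperties poset public using (<-trans; <⇒≉; <⇒≱)
  open ToStrict _≡_ _≤_ public using (<⇒≤)
  open Poset poset public using () renaming (refl to ≤-refl)

  Ord⇒≤ : ∀ {S a b} → Ord S a b → a ≤ b
  Ord⇒≤ [ _ , _ , a≤b , _ ]       = a≤b
  Ord⇒≤ ((_ , _ , a≤b , _) ∷ b→c) = ≤-trans a≤b (Ord⇒≤ b→c)

  greatest⇒Maximal : ∀ {S a} → a ∈ S → S ⊆ (_≤ a) → Maximal S a
  greatest⇒Maximal a∈S S≤a = a∈S , λ b b∈S a→b → antisym (S≤a b∈S) (Ord⇒≤ a→b)

  pair : Fin m → Fin m → Fin 2 → Fin m
  pair b a zero    = b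
  pair b a (suc _) = a

  covering⇒ConvexChain : ∀ {b a} → b < a → (∀ {y} → b < y → ¬ y < a) →
                         ConvexChain 1 (pair b a)
  covering⇒ConvexChain {b} {a} b<a covers = increasing , convex
    where
    increasing : ∀ i j → i <ᶠ j → pair b a i < pair b a j
    increasing zero       (suc zero) _        = b<a
    increasing (suc zero) (suc zero) (s≤s ())

    above-b : ∀ i → b ≤ pair b a i
    above-b zero    = ≤-refl
    above-b (suc _) = <⇒≤ b<a

    below-a : ∀ i → pair b a i ≤ a
    below-a zero    = <⇒≤ b<a
    below-a (suc _) = ≤-refl

    convex : ∀ y i j → pair b a i < y → y < pair b a j → Σ (Fin 2) λ l → y ≡ pair b a l
    convex y i zero x<y y<b = ⊥-elim (<⇒≱ (<-trans x<y y<b) (above-b i))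
    convex y (suc _) j a<y y<x = ⊥-elim (<⇒≱ (<-trans a<y y<x) (below-a j))
    convex y zero (suc _) b<y y<a = ⊥-elim (covers b<y y<a)

  P2⇒covering-labels-differ : P2 → ∀ {b a} → b < a → (∀ {y} → b < y → ¬ y < a) →
                               ε b ≢ ε a
  P2⇒covering-labels-differ p2 b<a covers =
    p2 1 _ (inj₁ refl) (covering⇒ConvexChain b<a covers)

module Chain {P : Set} {C : P → P → Set} (H : LHeap P C)
             (concurrent : ∀ u v → C u v) where
  open HeapProperties H

  ≤-total : ∀ a b → a ≤ b ⊎ b ≤ a
  ≤-total a b = comparable a b (concurrent (ε a) (ε b))

  totalOrder : TotalOrder 0ℓ 0ℓ 0ℓ
  totalOrder = record { isTotalOrder = record { isPartialOrder = isPO ; total = ≤-total } }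

  open TotalOrderProperties totalOrder using (decTotalOrder)
  open DecTotalOrder (decTotalOrder _≟_) using (_≤?_)

  _<?_ : ∀ a b → Dec (a < b)
  _<?_ = ToStrict.<-decidable _≡_ _≤_ _≟_ _≤?_

  ≮⇒≥ : ∀ {a b} → ¬ a < b → b ≤ a
  ≮⇒≥ = ToStrict.≮⇒≥ _≡_ _≤_ sym _≟_ (λ { refl → ≤-refl }) ≤-total

  ≤⇒Ord : ∀ {S a b} → a ∈ S → b ∈ S → a ≤ b → Ord S a b
  ≤⇒Ord a∈S b∈S a≤b = [ a∈S , b∈S , a≤b , concurrent _ _ ]

  Greatest : Pred (Fin m) 0ℓ → Fin m → Set
  Greatest Q a = a ∈ Q × Q ⊆ (_≤ a)

  empty-or-greatest : ∀ {Q} → Decidable Q → (∀ x → x ∉ Q) ⊎ ∃ (Greatest Q)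
  empty-or-greatest {Q} Q? with any? Q?
  ... | no  ∄x = inj₁ λ x x∈Q → ∄x (x , x∈Q)
  ... | yes (x , x∈Q) = inj₂ (climb x (po-noetherian isPO x) x∈Q)
    where
    climb : ∀ x → Acc (λ u v → v < u) x → x ∈ Q → ∃ (Greatest Q)
    climb x (acc above) x∈Q with any? (λ y → Q? y ×-dec x <? y)
    ... | yes (y , y∈Q , x<y) = climb y (above x<y) y∈Q
    ... | no  ∄y = x , x∈Q , λ {y} y∈Q → ≮⇒≥ λ x<y → ∄y (y , y∈Q , x<y)

  P2⇒ReachFromTrivial-downset : P2 → ∀ {S} a → Acc _<_ a → S ≐ (_≤ a) →
                                ReachFromTrivial S
  P2⇒ReachFromTrivial-downset p2 {S} a (acc below) (S⊆≤a , ≤a⊆S)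
    with empty-or-greatest (_<? a)
  ... | inj₁ nothing-below = base λ x y x∈S y∈S _ → trans (is-a x∈S) (sym (is-a y∈S))
    where
    is-a : ∀ {x} → x ∈ S → x ≡ a
    is-a {x} x∈S = antisym (S⊆≤a x∈S) (≮⇒≥ (nothing-below x))
  ... | inj₂ (b , b<a , <a⊆≤b) =
    step a (inj₁ (a-maximal , b , b-maximal , b-not-maximal , labels-differ))
      (P2⇒ReachFromTrivial-downset p2 b (below b<a) (S-a⊆≤b , ≤b⊆S-a))
    where
    a∈S : a ∈ S
    a∈S = ≤a⊆S ≤-refl

    S-a⊆≤b : remove S a ⊆ (_≤ b)
    S-a⊆≤b (x∈S , x≢a) = <a⊆≤b (S⊆≤a x∈S , x≢a)

    ≤b⊆S-a : (_≤ b) ⊆ remove S a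
    ≤b⊆S-a x≤b = ≤a⊆S (≤-trans x≤b (<⇒≤ b<a)) , λ { refl → <⇒≱ b<a x≤b }

    a-maximal : Maximal S a
    a-maximal = greatest⇒Maximal a∈S S⊆≤a

    b-maximal : Maximal (remove S a) b
    b-maximal = greatest⇒Maximal (≤b⊆S-a ≤-refl) S-a⊆≤b

    b-not-maximal : ¬ Maximal S b
    b-not-maximal (b∈S , b-top) = <⇒≉ b<a (sym (b-top a a∈S (≤⇒Ord b∈S a∈S (<⇒≤ b<a))))

    labels-differ : ε b ≢ ε a
    labels-differ = P2⇒covering-labels-differ p2 b<a λ b<y y<a → <⇒≱ b<y (<a⊆≤b y<a)

  P2⇒P1 : P2 → P1
  P2⇒P1 p2 with empty-or-greatest {Full} (λ _ → yes tt)
  ... | inj₁ empty = base λ x _ _ _ _ → ⊥-elim (empty x tt)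
  ... | inj₂ (top , _ , ≤top) =
    P2⇒ReachFromTrivial-downset p2 top (po-wellFounded isPO top) (≤top , λ _ → tt)

proposition3p2p2 : (n : ℕ) (P : Set) (C : P → P → Set) →
    Reflexive C → Symmetric C → P ↔ Fin n →
    (∀ v w → v ≢ w → C v w) → Regular P C
proposition3p2p2 n P C C-refl _ P↔Fin distinct⇒C H = Chain.P2⇒P1 H concurrent
  where
  concurrent : ∀ u v → C u v
  concurrent u v with inj⇒≟ (↔⇒↣ P↔Fin) u v
  ... | yes refl = C-refl
  ... | no  u≢v  = distinct⇒C u v u≢v
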